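{- Let $X$ be a finite non-empty set and $R$ a monotone transit function on $X$ satisfying (uc): for all $x,y,u,v\in X$, if $R(x,y)\cap R(u,v)\neq\emptyset$ then there are $p,q\in R(x,y)\cup R(u,v)$ with $R(x,y)\cup R(u,v)=R(p,q)$. Then $R$ satisfies (k): for all $u,v,x,y\in X$ with $R(u,v)\cap R(x,y)\neq\emptyset$ there are $p,q\in X$ such that $R(u,v)\cap R(x,y)=R(p,q)$.
   Context: A transit function on a finite non-empty set $X$ is a map $R:X\times X\to 2^X$ such that for all $u,v\in X$: $u\in R(u,v)$, $R(u,v)=R(v,u)$, and $R(u,u)=\{u\}$. $R$ is monotone if for all $u,v,p,q\in X$, $p,q\in R(u,v)$ implies $R(p,q)\subseteq R(u,v)$. -}

module Defs where

open import Data.Nat using (ℕ)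
open import Data.Fin using (Fin)
open import Data.Fin.Subset using (Subset; _∈_; _⊆_; ⁅_⁆; _∩_; _∪_)
open import Data.Product using (_×_; ∃; ∃-syntax)
open import Relation.Binary.PropositionalEquality using (_≡_)

-- X is modelled as Fin n (any finite set is in bijection with some Fin n);
-- non-emptiness is the hypothesis n ≥ 1 in the statement.
-- Subsets of X are Data.Fin.Subset n (characteristic vectors), so subset
-- equality is propositional equality _≡_ (extensional by construction).

Map : ℕ → Set
Map n = Fin n → Fin n → Subset n

IsTransit : ∀ {n} → Map n → Set
IsTransit {n} R =
  (∀ (u v : Fin n) → u ∈ R u v) ×
  (∀ (u v : Fin n) → R u v ≡ R v u) ×
  (∀ (u : Fin n) → R u u ≡ ⁅ u ⁆)

Monotone : ∀ {n} → Map n → Set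
Monotone {n} R = ∀ (u v p q : Fin n) → p ∈ R u v → q ∈ R u v → R p q ⊆ R u v

Meets : ∀ {n} → Subset n → Subset n → Set
Meets {n} A B = ∃[ z ] (z ∈ A × z ∈ B)

UC : ∀ {n} → Map n → Set
UC {n} R = ∀ (x y u v : Fin n) → Meets (R x y) (R u v) →
  ∃[ p ] ∃[ q ] (p ∈ (R x y ∪ R u v) × q ∈ (R x y ∪ R u v) ×
                 (R x y ∪ R u v) ≡ R p q)

K : ∀ {n} → Map n → Set
K {n} R = ∀ (u v x y : Fin n) → Meets (R u v) (R x y) →
  ∃[ p ] ∃[ q ] ((R u v ∩ R x y) ≡ R p q)

-- Let C = R(u,v) ∩ R(x,y). By monotonicity C is convex: R(p,q) ⊆ C whenever
-- p, q ∈ C. For p, q, z ∈ C the sets R(p,q) and R(p,z) meet in p, so (uc)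
-- gives an interval R(a,b) = R(p,q) ∪ R(p,z), which still lies in C and
-- has its endpoints in C. Starting from any point of C and absorbing the
-- points of the finite set C one at a time yields endpoints p, q ∈ C with
-- C ⊆ R(p,q) ⊆ C.
module Submission where

open import Defs
open import Data.Nat using (ℕ; _≥_)
open import Data.Fin using (Fin)
open import Data.Fin.Subset using (Subset; _∈_; _⊆_; _∩_; _∪_)
open import Data.Fin.Subset.Properties
  using (_∈?_; ⊆-antisym; x∈p∩q⁺; x∈p∩q⁻; x∈p∪q⁺; x∈p∪q⁻)
open import Data.Product using (_×_; _,_; ∃-syntax)
open import Data.Sum using (inj₁; inj₂; [_,_])
open import Function using (_∘_)
open import Data.List using (List; []; _∷_; allFin)
open import Data.List.Relation.Unary.All as All using (All; []; _∷_)
open import Data.List.Membership.Propositional.Properties using (∈-allFin)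
open import Relation.Nullary using (yes; no; contradiction)
open import Relation.Binary.PropositionalEquality using (_≡_; subst)

Convex : ∀ {n} → Map n → Subset n → Set
Convex {n} R S = ∀ {p q : Fin n} → p ∈ S → q ∈ S → R p q ⊆ S

module _ {n : ℕ} {R : Map n} where

  interval-convex : Monotone R → ∀ u v → Convex R (R u v)
  interval-convex mono u v = mono u v _ _

  ∩-convex : ∀ {A B} → Convex R A → Convex R B → Convex R (A ∩ B)
  ∩-convex {A} {B} convexA convexB p∈A∩B q∈A∩B z∈Rpq =
    let p∈A , p∈B = x∈p∩q⁻ A B p∈A∩B
        q∈A , q∈B = x∈p∩q⁻ A B q∈A∩B
    in x∈p∩q⁺ (convexA p∈A q∈A z∈Rpq , convexB p∈B q∈B z∈Rpq)

  ∈-right : IsTransit R → ∀ p q → q ∈ R p q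
  ∈-right (∈-left , symmetric , _) p q = subst (q ∈_) (symmetric q p) (∈-left q p)

  module _ (transit : IsTransit R) (uc : UC R) {S : Subset n} (convex : Convex R S) where

    enlarge-interval : ∀ {p q z} → p ∈ S → q ∈ S → z ∈ S →
      ∃[ a ] ∃[ b ] (a ∈ S × b ∈ S × R p q ⊆ R a b × z ∈ R a b)
    enlarge-interval {p} {q} {z} p∈S q∈S z∈S =
      let ∈-left , _ = transit
          a , b , a∈∪ , b∈∪ , ∪≡Rab = uc p q p z (p , ∈-left p q , ∈-left p z)
          ∪⊆Rab : R p q ∪ R p z ⊆ R a b
          ∪⊆Rab w∈∪ = subst (_ ∈_) ∪≡Rab w∈∪
          ∪⊆S : R p q ∪ R p z ⊆ S
          ∪⊆S w∈∪ = [ convex p∈S q∈S , convex p∈S z∈S ] (x∈p∪q⁻ (R p q) (R p z) w∈∪)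
      in a , b , ∪⊆S a∈∪ , ∪⊆S b∈∪ ,
         (λ w∈Rpq → ∪⊆Rab (x∈p∪q⁺ (inj₁ w∈Rpq))) ,
         ∪⊆Rab (x∈p∪q⁺ (inj₂ (∈-right transit p z)))

    interval-covering : ∀ {z₀} → z₀ ∈ S → (L : List (Fin n)) →
      ∃[ p ] ∃[ q ] (p ∈ S × q ∈ S × All (λ z → z ∈ S → z ∈ R p q) L)
    interval-covering z₀∈S [] = _ , _ , z₀∈S , z₀∈S , []
    interval-covering z₀∈S (z ∷ L) with interval-covering z₀∈S L | z ∈? S
    ... | p , q , p∈S , q∈S , covered | no z∉S =
      p , q , p∈S , q∈S , (λ z∈S → contradiction z∈S z∉S) ∷ covered
    ... | p , q , p∈S , q∈S , covered | yes z∈S =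
      let a , b , a∈S , b∈S , Rpq⊆Rab , z∈Rab = enlarge-interval p∈S q∈S z∈S
      in a , b , a∈S , b∈S , (λ _ → z∈Rab) ∷ All.map (Rpq⊆Rab ∘_) covered

    convex⇒interval : ∀ {z₀} → z₀ ∈ S → ∃[ p ] ∃[ q ] (S ≡ R p q)
    convex⇒interval z₀∈S =
      let p , q , p∈S , q∈S , covered = interval-covering z₀∈S (allFin n)
      in p , q , ⊆-antisym (λ {z} → All.lookup covered (∈-allFin z)) (convex p∈S q∈S)

lemma5 : (n : ℕ) → n ≥ 1 → (R : Map n) → IsTransit R → Monotone R → UC R → K R
-- n ≥ 1 is unused: the common point of the two intervals already makes X non-empty.
lemma5 n _ R transit mono uc u v x y (z , z∈Ruv , z∈Rxy) =
  convex⇒interval transit uc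
    (∩-convex (interval-convex mono u v) (interval-convex mono x y))
    (x∈p∩q⁺ (z∈Ruv , z∈Rxy))
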